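{- Let $R$ be a finite commutative ring with identity, written as a direct sum of local rings $R = R_1\oplus\cdots\oplus R_n$, where $R_i$ has unique maximal ideal $M_i$ and residue field of size $q_i = |R_i/M_i|$. Let $R^*$ denote the group of units of $R$, and for an integer $k\ge 1$ let $\sum_{i=1}^k R^* = \{x_1+\cdots+x_k : x_1,\ldots,x_k\in R^*\}$. (i) If $q_i>2$ for each $i=1,\ldots,n$, then $R^*+R^* = R$. (ii) Suppose $q_1=\cdots=q_s=2$ for some $s\ge 1$ and $q_j>2$ for each $j>s$. Then for any integer $k\ge 2$, $\sum_{i=1}^k R^*$ equals the set of $(c_1,\ldots,c_n)\in R$ such that: if $k$ is even, $c_i\in M_i$ for all $i\le s$; if $k$ is odd, $c_i\in R_i\setminus M_i$ for all $i\le s$; with $c_j\in R_j$ arbitrary for $j>s$ (if $s=n$ there are no such $j$). In particular, every element of $R$ is a sum of units of $R$ if and only if $s=1$.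
   Context: Every finite commutative ring with identity is uniquely a direct sum of finite local rings; elements of $R$ are written as tuples $(c_1,\ldots,c_n)$ with $c_i\in R_i$. -}

module Defs where

open import Level using (Level; _⊔_) renaming (suc to lsuc)
open import Data.Nat using (ℕ)
open import Data.Fin using (Fin)
open import Data.Product using (Σ; ∃; _×_; _,_)
open import Data.Sum using (_⊎_)
open import Relation.Nullary using (¬_)
open import Relation.Unary using (Pred)
open import Relation.Binary.PropositionalEquality using (_≡_)
open import Algebra.Bundles using (CommutativeRing)
open import Algebra.Bundles.Raw using (RawRing)

module _ {c ℓ} (R : RawRing c ℓ) where
  open RawRing R

  IsUnit : Carrier → Set (c ⊔ ℓ)
  IsUnit x = ∃ λ y → x * y ≈ 1#

  sumᶠ : ∀ k → (Fin k → Carrier) → Carrier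
  sumᶠ ℕ.zero  u = 0#
  sumᶠ (ℕ.suc k) u = u Fin.zero + sumᶠ k (λ i → u (Fin.suc i))

  SumOfUnits : ℕ → Carrier → Set (c ⊔ ℓ)
  SumOfUnits k x = Σ (Fin k → Carrier) λ u → (∀ i → IsUnit (u i)) × (x ≈ sumᶠ k u)

module _ {c ℓ} (R : CommutativeRing c ℓ) where
  open CommutativeRing R

  record IsIdeal (I : Pred Carrier (c ⊔ ℓ)) : Set (c ⊔ ℓ) where
    field
      resp  : ∀ {x y} → x ≈ y → I x → I y
      zero∈ : I 0#
      +∈    : ∀ {x y} → I x → I y → I (x + y)
      *∈    : ∀ r {x} → I x → I (r * x)

  record IsMaximalIdeal (M : Pred Carrier (c ⊔ ℓ)) : Set (lsuc (c ⊔ ℓ)) where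
    field
      isIdeal : IsIdeal M
      proper  : ¬ M 1#
      maximal : ∀ (J : Pred Carrier (c ⊔ ℓ)) → IsIdeal J →
                (∀ {x} → M x → J x) →
                (∀ {x} → J x → M x) ⊎ (∀ x → J x)

  record IsFinite : Set (c ⊔ ℓ) where
    field
      size    : ℕ
      to      : Carrier → Fin size
      from    : Fin size → Carrier
      to-cong : ∀ {x y} → x ≈ y → to x ≡ to y
      from-to : ∀ x → from (to x) ≈ x
      to-from : ∀ i → to (from i) ≡ i

record FiniteLocalRing c ℓ : Set (lsuc (c ⊔ ℓ)) where
  field
    cring      : CommutativeRing c ℓ
  open CommutativeRing cring
  field
    finite     : IsFinite cring
    M          : Pred Carrier (c ⊔ ℓ)
    M-maximal  : IsMaximalIdeal cring M
    M-unique   : ∀ (N : Pred Carrier (c ⊔ ℓ)) → IsMaximalIdeal cring N →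
                 (∀ {x} → N x → M x) × (∀ {x} → M x → N x)

  -- |R/M| = q : there are q pairwise distinct cosets x + M covering R
  ResidueSize : ℕ → Set (c ⊔ ℓ)
  ResidueSize q = Σ (Fin q → Carrier) λ f →
    (∀ x → ∃ λ i → M (x - f i)) × (∀ i j → M (f i - f j) → i ≡ j)

module _ {c ℓ} {n : ℕ} (Rs : Fin n → FiniteLocalRing c ℓ) where
  private
    module Rᵢ (i : Fin n) = CommutativeRing (FiniteLocalRing.cring (Rs i))

  DirectSum : RawRing c ℓ
  DirectSum = record
    { Carrier = (i : Fin n) → Rᵢ.Carrier i
    ; _≈_     = λ x y → ∀ i → Rᵢ._≈_ i (x i) (y i)
    ; _+_     = λ x y i → Rᵢ._+_ i (x i) (y i)
    ; _*_     = λ x y i → Rᵢ._*_ i (x i) (y i)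
    ; -_      = λ x i → Rᵢ.-_ i (x i)
    ; 0#      = λ i → Rᵢ.0# i
    ; 1#      = λ i → Rᵢ.1# i
    }

-- In a finite local ring the units are exactly the elements outside M: a non-unit generates a
-- proper ideal, which finiteness lets us extend to a maximal ideal, and that ideal must be M.
-- If the residue field has more than two elements, x = a + (x - a) for a unit a whose class avoids
-- those of 0 and x, and further summands come from x = 1 + (x - 1). If the residue field is F₂,
-- all units are congruent to 1 modulo M, so a sum of k units lies in M exactly when k is even,
-- and subtracting 1's shows that every x of the right parity is such a sum. Everything is
-- componentwise in the direct sum: with two F₂ components, (1, 0, …, 0) would need an odd and an
-- even number of summands, while with one, every x is a sum of two or of three units.

module Submission where

open import Defs
open import Level using (_⊔_)
open import Axiom.ExcludedMiddle using (ExcludedMiddle)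
open import Data.Nat using (ℕ; zero; suc; _<_; _≤_; _≤′_; ≤′-refl; ≤′-step; z≤n; s≤s; _<?_)
open import Data.Nat.Properties using (<⇒<′; <⇒≤; ≤⇒≤′; z≤′n; ≮⇒≥)
import Data.Nat.Properties as ℕₚ
open import Data.Nat.Divisibility using (_∣_; _∣?_; divides; ∣m+n∣m⇒∣n; ∣1⇒≡1)
open import Data.Fin using (Fin; toℕ; fromℕ<)
open import Data.Fin.Properties using (fromℕ<-toℕ; toℕ<n)
open import Data.Vec.Functional using (_∷_)
open import Data.Product using (∃; ∃₂; _×_; _,_; proj₁; proj₂; map₂; swap)
open import Data.Sum using (_⊎_; inj₁; inj₂)
open import Data.Empty using (⊥-elim)
open import Function using (_∘_)
open import Function.Bundles using (_⇔_; mk⇔; Equivalence)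
open import Relation.Nullary using (¬_; Dec; yes; no; contradiction)
open import Relation.Unary using (Pred; _∈_; _⊆_)
open import Relation.Binary.PropositionalEquality using (_≡_; _≢_)
import Relation.Binary.PropositionalEquality as ≡
open import Algebra.Bundles using (CommutativeRing)
open import Algebra.Bundles.Raw using (RawRing)

2∣⊎2∣suc : ∀ k → 2 ∣ k ⊎ 2 ∣ suc k
2∣⊎2∣suc zero = inj₁ (divides 0 ≡.refl)
2∣⊎2∣suc (suc k) with 2∣⊎2∣suc k
... | inj₁ (divides q k≡q*2) = inj₂ (divides (suc q) (≡.cong (suc ∘ suc) k≡q*2))
... | inj₂ 2∣1+k             = inj₁ 2∣1+k

2∣⇒2∤suc : ∀ {k} → 2 ∣ k → ¬ 2 ∣ suc k
2∣⇒2∤suc {k} 2∣k 2∣1+k with ∣1⇒≡1 (∣m+n∣m⇒∣n (≡.subst (2 ∣_) (ℕₚ.+-comm 1 k) 2∣1+k) 2∣k)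
... | ()

2∤suc⇒2∣ : ∀ {k} → ¬ 2 ∣ suc k → 2 ∣ k
2∤suc⇒2∣ {k} 2∤1+k with 2∣⊎2∣suc k
... | inj₁ 2∣k   = 2∣k
... | inj₂ 2∣1+k = contradiction 2∣1+k 2∤1+k

2∤⇒2∣suc : ∀ {k} → ¬ 2 ∣ k → 2 ∣ suc k
2∤⇒2∣suc {k} 2∤k with 2∣⊎2∣suc k
... | inj₁ 2∣k   = contradiction 2∣k 2∤k
... | inj₂ 2∣1+k = 2∣1+k

≢-≢⇒≡-Fin2 : {i j o : Fin 2} → i ≢ o → j ≢ o → i ≡ j
≢-≢⇒≡-Fin2 {Fin.zero}   {Fin.zero}   _ _ = ≡.refl
≢-≢⇒≡-Fin2 {Fin.suc Fin.zero} {Fin.suc Fin.zero} _ _ = ≡.refl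
≢-≢⇒≡-Fin2 {Fin.zero} {Fin.suc Fin.zero} {Fin.zero}         i≢o _   = contradiction ≡.refl i≢o
≢-≢⇒≡-Fin2 {Fin.zero} {Fin.suc Fin.zero} {Fin.suc Fin.zero} _   j≢o = contradiction ≡.refl j≢o
≢-≢⇒≡-Fin2 {Fin.suc Fin.zero} {Fin.zero} {Fin.zero}         _   j≢o = contradiction ≡.refl j≢o
≢-≢⇒≡-Fin2 {Fin.suc Fin.zero} {Fin.zero} {Fin.suc Fin.zero} i≢o _   = contradiction ≡.refl i≢o

module RingProperties {c ℓ} (R : CommutativeRing c ℓ) where
  open CommutativeRing R
  open import Algebra.Properties.AbelianGroup +-abelianGroup
    using (xyx⁻¹≈y; \\-leftDividesʳ; ⁻¹-anti-homo‿-; ⁻¹-involutive; ε⁻¹≈ε)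
  open import Algebra.Properties.CommutativeSemigroup +-commutativeSemigroup using (x∙yz≈y∙xz)
  open import Relation.Binary.Reasoning.Setoid setoid

  Subset : Set _
  Subset = Pred Carrier (c ⊔ ℓ)

  x≈a+[x-a] : ∀ x a → x ≈ a + (x - a)
  x≈a+[x-a] x a = sym (trans (sym (+-assoc a x (- a))) (xyx⁻¹≈y a x))

  [a-b]+[b-c]≈a-c : ∀ a b c → (a - b) + (b - c) ≈ a - c
  [a-b]+[b-c]≈a-c a b c = begin
    (a - b) + (b - c) ≈⟨ +-assoc a (- b) (b - c) ⟩
    a + (- b + (b - c)) ≈⟨ +-congˡ (\\-leftDividesʳ b (- c)) ⟩
    a - c ∎

  x-0≈x : ∀ x → x - 0# ≈ x
  x-0≈x x = trans (+-congˡ ε⁻¹≈ε) (+-identityʳ x)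

  IsUnit′ : Carrier → Set (c ⊔ ℓ)
  IsUnit′ = IsUnit rawRing

  SumOfUnits′ : ℕ → Carrier → Set (c ⊔ ℓ)
  SumOfUnits′ = SumOfUnits rawRing

  1-unit : IsUnit′ 1#
  1-unit = 1# , *-identityʳ 1#

  sumOfUnits-one : ∀ {x} → IsUnit′ x → SumOfUnits′ 1 x
  sumOfUnits-one {x} x-unit = (λ _ → x) , (λ _ → x-unit) , sym (+-identityʳ x)

  sumOfUnits-cons : ∀ {k a x} → IsUnit′ a → SumOfUnits′ k (x - a) →
                    SumOfUnits′ (suc k) x
  sumOfUnits-cons {k} {a} {x} a-unit (u , u-units , x-a≈Σu) =
    a ∷ u , units , trans (x≈a+[x-a] x a) (+-congˡ x-a≈Σu)
    where
    units : ∀ i → IsUnit′ ((a ∷ u) i)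
    units Fin.zero    = a-unit
    units (Fin.suc i) = u-units i

  allSumsOfUnits-suc : ∀ {k} → (∀ x → SumOfUnits′ k x) → ∀ x → SumOfUnits′ (suc k) x
  allSumsOfUnits-suc all x = sumOfUnits-cons 1-unit (all (x - 1#))

  allSumsOfUnits-≤ : ∀ {k} → (∀ x → SumOfUnits′ k x) → ∀ {m} → k ≤′ m → ∀ x → SumOfUnits′ m x
  allSumsOfUnits-≤ all ≤′-refl        = all
  allSumsOfUnits-≤ all (≤′-step k≤′m) = allSumsOfUnits-suc (allSumsOfUnits-≤ all k≤′m)

  -- Maximality applied to the ideal {x | P or x ∈ M}, which is M when P fails and R when P holds.
  maximal⇒excludedMiddle : ∀ {M} → IsMaximalIdeal R M → ExcludedMiddle (c ⊔ ℓ)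
  maximal⇒excludedMiddle {M} M-maximal {P} with maximal (λ x → P ⊎ M x) P∪M-isIdeal inj₂
    where
    open IsMaximalIdeal M-maximal
    open IsIdeal isIdeal
    P∪M-isIdeal : IsIdeal R (λ x → P ⊎ M x)
    P∪M-isIdeal = record
      { resp  = λ { x≈y (inj₁ p) → inj₁ p ; x≈y (inj₂ m) → inj₂ (resp x≈y m) }
      ; zero∈ = inj₂ zero∈
      ; +∈    = λ { (inj₁ p) _ → inj₁ p ; (inj₂ _) (inj₁ p) → inj₁ p
                  ; (inj₂ m) (inj₂ m′) → inj₂ (+∈ m m′) }
      ; *∈    = λ { r (inj₁ p) → inj₁ p ; r (inj₂ m) → inj₂ (*∈ r m) }
      }
  ... | inj₁ P∪M⊆M = no (IsMaximalIdeal.proper M-maximal ∘ P∪M⊆M ∘ inj₁)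
  ... | inj₂ P∪M≡R with P∪M≡R 1#
  ...   | inj₁ p  = yes p
  ...   | inj₂ m1 = contradiction m1 (IsMaximalIdeal.proper M-maximal)

  infixl 6 _+⟨_⟩

  _+⟨_⟩ : Subset → Carrier → Subset
  (I +⟨ w ⟩) x = ∃₂ λ i r → I i × x ≈ i + r * w

  module _ {I : Subset} (I-isIdeal : IsIdeal R I) where
    open IsIdeal I-isIdeal

    +⟨⟩-isIdeal : ∀ w → IsIdeal R (I +⟨ w ⟩)
    +⟨⟩-isIdeal w = record
      { resp  = λ { x≈y (i , r , i∈I , x≈i+rw) → i , r , i∈I , trans (sym x≈y) x≈i+rw }
      ; zero∈ = 0# , 0# , zero∈ , sym (trans (+-identityˡ _) (zeroˡ w))
      ; +∈    = λ { (i , r , i∈I , x≈) (j , s , j∈I , y≈) →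
                    i + j , r + s , +∈ i∈I j∈I , trans (+-cong x≈ y≈) (regroup i r j s) }
      ; *∈    = λ { t (i , r , i∈I , x≈) →
                    t * i , t * r , *∈ t i∈I ,
                    trans (*-congˡ x≈) (trans (distribˡ t i (r * w)) (+-congˡ (sym (*-assoc t r w)))) }
      }
      where
      regroup : ∀ i r j s → (i + r * w) + (j + s * w) ≈ (i + j) + (r + s) * w
      regroup i r j s = begin
        (i + r * w) + (j + s * w) ≈⟨ +-assoc i (r * w) (j + s * w) ⟩
        i + (r * w + (j + s * w)) ≈⟨ +-congˡ (x∙yz≈y∙xz (r * w) j (s * w)) ⟩
        i + (j + (r * w + s * w)) ≈⟨ +-assoc i j (r * w + s * w) ⟨
        (i + j) + (r * w + s * w) ≈⟨ +-congˡ (distribʳ w r s) ⟨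
        (i + j) + (r + s) * w ∎

    ⊆-+⟨⟩ : ∀ w → I ⊆ I +⟨ w ⟩
    ⊆-+⟨⟩ w {x} x∈I = x , 0# , x∈I , sym (trans (+-congˡ (zeroˡ w)) (+-identityʳ x))

    ∈-+⟨⟩ : ∀ w → w ∈ I +⟨ w ⟩
    ∈-+⟨⟩ w = 0# , 1# , zero∈ , sym (trans (+-identityˡ _) (*-identityˡ w))

  ⟨_⟩ : Carrier → Subset
  ⟨ z ⟩ x = ∃ λ r → x ≈ r * z

  ⟨⟩-isIdeal : ∀ z → IsIdeal R ⟨ z ⟩
  ⟨⟩-isIdeal z = record
    { resp  = λ { x≈y (r , x≈rz) → r , trans (sym x≈y) x≈rz }
    ; zero∈ = 0# , sym (zeroˡ z)
    ; +∈    = λ { (r , x≈rz) (s , y≈sz) → r + s , trans (+-cong x≈rz y≈sz) (sym (distribʳ z r s)) }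
    ; *∈    = λ { t (r , x≈rz) → t * r , trans (*-congˡ x≈rz) (sym (*-assoc t r z)) }
    }

  ∈⟨⟩ : ∀ z → z ∈ ⟨ z ⟩
  ∈⟨⟩ z = 1# , sym (*-identityˡ z)

  nonunit⇒⟨⟩-proper : ∀ {z} → ¬ IsUnit′ z → ¬ 1# ∈ ⟨ z ⟩
  nonunit⇒⟨⟩-proper {z} z-nonunit (r , 1≈rz) = z-nonunit (r , sym (trans 1≈rz (*-comm r z)))

  -- Adjoin the elements of the finite ring one after the other, skipping those that would make the
  -- ideal improper; the last ideal of the chain is maximal.
  module ExtendToMaximal (em : ExcludedMiddle (c ⊔ ℓ)) (finite : IsFinite R) where
    open IsFinite finite

    enum : ℕ → Carrier
    enum t with t <? size
    ... | yes t<size = from (fromℕ< t<size)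
    ... | no _       = 0#

    enum-to : ∀ x → enum (toℕ (to x)) ≈ x
    enum-to x with toℕ (to x) <? size
    ... | yes t<size = trans (reflexive (≡.cong from (fromℕ<-toℕ (to x) t<size))) (from-to x)
    ... | no t≮size  = contradiction (toℕ<n (to x)) t≮size

    grow : (I : Subset) (w : Carrier) → Dec (1# ∈ I +⟨ w ⟩) → Subset
    grow I w (yes _) = I
    grow I w (no _)  = I +⟨ w ⟩

    module _ {I : Subset} (I-isIdeal : IsIdeal R I) (w : Carrier) where

      grow-isIdeal : ∀ d → IsIdeal R (grow I w d)
      grow-isIdeal (yes _) = I-isIdeal
      grow-isIdeal (no _)  = +⟨⟩-isIdeal I-isIdeal w

      grow-proper : ¬ 1# ∈ I → ∀ d → ¬ 1# ∈ grow I w d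
      grow-proper 1∉I (yes _)  = 1∉I
      grow-proper _   (no 1∉J) = 1∉J

      ⊆-grow : ∀ d → I ⊆ grow I w d
      ⊆-grow (yes _) = λ x∈I → x∈I
      ⊆-grow (no _)  = ⊆-+⟨⟩ I-isIdeal w

      grow-absorbs : ∀ d → 1# ∈ I +⟨ w ⟩ ⊎ w ∈ grow I w d
      grow-absorbs (yes 1∈J) = inj₁ 1∈J
      grow-absorbs (no _)    = inj₂ (∈-+⟨⟩ I-isIdeal w)

    module _ {I : Subset} (I-isIdeal : IsIdeal R I) (I-proper : ¬ 1# ∈ I) where

      chain : ℕ → Subset
      chain zero    = I
      chain (suc t) = grow (chain t) (enum t) em

      chain-isIdeal : ∀ t → IsIdeal R (chain t)
      chain-isIdeal zero    = I-isIdeal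
      chain-isIdeal (suc t) = grow-isIdeal (chain-isIdeal t) (enum t) em

      chain-proper : ∀ t → ¬ 1# ∈ chain t
      chain-proper zero    = I-proper
      chain-proper (suc t) = grow-proper (chain-isIdeal t) (enum t) (chain-proper t) em

      chain-mono : ∀ {t t′} → t ≤′ t′ → chain t ⊆ chain t′
      chain-mono ≤′-refl = λ x∈chain → x∈chain
      chain-mono {t′ = suc t′} (≤′-step t≤′t′) {x} x∈chain =
        ⊆-grow (chain-isIdeal t′) (enum t′) em (chain-mono t≤′t′ x∈chain)

      N : Subset
      N = chain size

      I⊆N : I ⊆ N
      I⊆N = chain-mono {0} {size} z≤′n

      1∈N+⟨x⟩⊎x∈N : ∀ x → 1# ∈ N +⟨ x ⟩ ⊎ x ∈ N
      1∈N+⟨x⟩⊎x∈N x with grow-absorbs (chain-isIdeal t) (enum t) em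
        where t = toℕ (to x)
      ... | inj₁ (i , r , i∈chain , 1≈i+r·enum) =
        inj₁ (i , r , chain-mono (≤⇒≤′ (<⇒≤ (toℕ<n (to x)))) i∈chain ,
              trans 1≈i+r·enum (+-congˡ (*-congˡ (enum-to x))))
      ... | inj₂ enum∈chain =
        inj₂ (IsIdeal.resp (chain-isIdeal size) (enum-to x) (chain-mono (<⇒<′ (toℕ<n (to x))) enum∈chain))

      N-isMaximal : IsMaximalIdeal R N
      N-isMaximal = record
        { isIdeal = chain-isIdeal size
        ; proper  = chain-proper size
        ; maximal = maximal
        }
        where
        maximal : ∀ J → IsIdeal R J → N ⊆ J → J ⊆ N ⊎ (∀ x → J x)
        maximal J J-isIdeal N⊆J with em {1# ∈ J}
        ... | yes 1∈J = inj₂ λ x → resp (*-identityʳ x) (*∈ x 1∈J)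
          where open IsIdeal J-isIdeal
        ... | no 1∉J  = inj₁ J⊆N
          where
          open IsIdeal J-isIdeal
          J⊆N : J ⊆ N
          J⊆N {x} x∈J with 1∈N+⟨x⟩⊎x∈N x
          ... | inj₂ x∈N = x∈N
          ... | inj₁ (i , r , i∈N , 1≈i+rx) =
            contradiction (resp (sym 1≈i+rx) (+∈ (N⊆J i∈N) (*∈ r x∈J))) 1∉J

      extendToMaximal : ∃ λ N → IsMaximalIdeal R N × I ⊆ N
      extendToMaximal = N , N-isMaximal , I⊆N

module FiniteLocalRingProperties {c ℓ} (L : FiniteLocalRing c ℓ) where
  open FiniteLocalRing L
  open CommutativeRing cring
  open RingProperties cring
  open IsMaximalIdeal M-maximal using (proper)
  open IsIdeal (IsMaximalIdeal.isIdeal M-maximal)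
    renaming (resp to M-resp; zero∈ to 0∈M; +∈ to +∈M; *∈ to *∈M)
  open import Algebra.Properties.Ring ring using (-1*x≈-x)
  open import Algebra.Properties.AbelianGroup +-abelianGroup
    using (//-rightDividesʳ; ⁻¹-anti-homo‿-; ⁻¹-involutive)

  em : ExcludedMiddle (c ⊔ ℓ)
  em = maximal⇒excludedMiddle M-maximal

  unit⇒∉M : ∀ {x} → IsUnit′ x → ¬ M x
  unit⇒∉M {x} (y , xy≈1) x∈M = proper (M-resp (trans (*-comm y x) xy≈1) (*∈M y x∈M))

  nonunit⇒∈M : ∀ {z} → ¬ IsUnit′ z → M z
  nonunit⇒∈M {z} z-nonunit =
    let N , N-isMaximal , ⟨z⟩⊆N = ExtendToMaximal.extendToMaximal em finite
                                    (⟨⟩-isIdeal z) (nonunit⇒⟨⟩-proper z-nonunit)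
    in proj₁ (M-unique N N-isMaximal) (⟨z⟩⊆N (∈⟨⟩ z))

  ∉M⇒unit : ∀ {x} → ¬ M x → IsUnit′ x
  ∉M⇒unit {x} x∉M with em {IsUnit′ x}
  ... | yes x-unit    = x-unit
  ... | no x-nonunit  = contradiction (nonunit⇒∈M x-nonunit) x∉M

  -‿∈M : ∀ {a} → M a → M (- a)
  -‿∈M {a} a∈M = M-resp (-1*x≈-x a) (*∈M (- 1#) a∈M)

  ∉M-+-∈M : ∀ {a b} → ¬ M a → M b → ¬ M (a + b)
  ∉M-+-∈M {a} {b} a∉M b∈M a+b∈M = a∉M (M-resp (//-rightDividesʳ b a) (+∈M a+b∈M (-‿∈M b∈M)))

  infix 4 _≋_

  _≋_ : Carrier → Carrier → Set (c ⊔ ℓ)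
  a ≋ b = M (a - b)

  ≋-sym : ∀ {a b} → a ≋ b → b ≋ a
  ≋-sym {a} {b} a≋b = M-resp (⁻¹-anti-homo‿- a b) (-‿∈M a≋b)

  ≋-trans : ∀ {a b c} → a ≋ b → b ≋ c → a ≋ c
  ≋-trans {a} {b} {c} a≋b b≋c = M-resp ([a-b]+[b-c]≈a-c a b c) (+∈M a≋b b≋c)

  ∈M⇒≋0 : ∀ {a} → M a → a ≋ 0#
  ∈M⇒≋0 {a} a∈M = M-resp (sym (x-0≈x a)) a∈M

  ≋0⇒∈M : ∀ {a} → a ≋ 0# → M a
  ≋0⇒∈M {a} = M-resp (x-0≈x a)

  -- x = a + (x - a) for any a outside the residue classes of 0 and x, and three classes leave room for one.
  residue>2⇒sumOfTwoUnits : ∀ {q} → 2 < q → ResidueSize q → ∀ x → SumOfUnits′ 2 x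
  residue>2⇒sumOfTwoUnits {suc (suc (suc _))} (s≤s (s≤s (s≤s _))) (f , _ , distinct) x =
    let i , fᵢ≉0 , fᵢ≉x = avoiding 0# x
    in sumOfUnits-cons (∉M⇒unit (fᵢ≉0 ∘ ∈M⇒≋0))
                       (sumOfUnits-one (∉M⇒unit (fᵢ≉x ∘ ≋-sym)))
    where
    unique : ∀ {i j a} → f i ≋ a → f j ≋ a → i ≡ j
    unique fᵢ≋a fⱼ≋a = distinct _ _ (≋-trans fᵢ≋a (≋-sym fⱼ≋a))

    oneOf12Avoids : ∀ b → ¬ f (Fin.suc Fin.zero) ≋ b ⊎ ¬ f (Fin.suc (Fin.suc Fin.zero)) ≋ b
    oneOf12Avoids b with em {f (Fin.suc Fin.zero) ≋ b}
    ... | no f₁≉b = inj₁ f₁≉b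
    ... | yes f₁≋b = inj₂ λ f₂≋b → contradiction (unique f₁≋b f₂≋b) λ ()

    avoidingIf0Hits : ∀ {a} → f Fin.zero ≋ a → ∀ b → ∃ λ i → ¬ f i ≋ a × ¬ f i ≋ b
    avoidingIf0Hits f₀≋a b with oneOf12Avoids b
    ... | inj₁ f₁≉b = Fin.suc Fin.zero , (λ f₁≋a → contradiction (unique f₁≋a f₀≋a) λ ()) , f₁≉b
    ... | inj₂ f₂≉b = Fin.suc (Fin.suc Fin.zero) , (λ f₂≋a → contradiction (unique f₂≋a f₀≋a) λ ()) , f₂≉b

    avoiding : ∀ a b → ∃ λ i → ¬ f i ≋ a × ¬ f i ≋ b
    avoiding a b with em {f Fin.zero ≋ a} | em {f Fin.zero ≋ b}
    ... | yes f₀≋a | _        = avoidingIf0Hits f₀≋a b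
    ... | no _     | yes f₀≋b = map₂ swap (avoidingIf0Hits f₀≋b a)
    ... | no f₀≉a  | no f₀≉b  = Fin.zero , f₀≉a , f₀≉b

  residue>2⇒sumOfUnits : ∀ {q} → 2 < q → ResidueSize q → ∀ {k} → 2 ≤ k → ∀ x → SumOfUnits′ k x
  residue>2⇒sumOfUnits 2<q residue 2≤k =
    allSumsOfUnits-≤ (residue>2⇒sumOfTwoUnits 2<q residue) (≤⇒≤′ 2≤k)

  Parity : ℕ → Carrier → Set (c ⊔ ℓ)
  Parity k x = (2 ∣ k → M x) × (¬ 2 ∣ k → ¬ M x)

  Parity-resp : ∀ {k x y} → x ≈ y → Parity k x → Parity k y
  Parity-resp x≈y (even , odd) = M-resp x≈y ∘ even , λ 2∤k → odd 2∤k ∘ M-resp (sym x≈y)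

  module ResidueTwo (residue : ResidueSize 2) where
    private
      f     = proj₁ residue
      cover = proj₁ (proj₂ residue)

    ∉M⇒≋ : ∀ {a b} → ¬ M a → ¬ M b → a ≋ b
    ∉M⇒≋ {a} {b} a∉M b∉M = ≋-trans a≋fᵢ (≡.subst (λ j → f j ≋ b) (≡.sym i≡j) (≋-sym b≋fⱼ))
      where
      i = proj₁ (cover a) ; a≋fᵢ = proj₂ (cover a)
      j = proj₁ (cover b) ; b≋fⱼ = proj₂ (cover b)
      o = proj₁ (cover 0#) ; 0≋fₒ = proj₂ (cover 0#)
      ≢o : ∀ {y} → ¬ M y → ∀ {k} → y ≋ f k → k ≢ o
      ≢o y∉M y≋fₖ ≡.refl = y∉M (≋0⇒∈M (≋-trans y≋fₖ (≋-sym 0≋fₒ)))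
      i≡j : i ≡ j
      i≡j = ≢-≢⇒≡-Fin2 (≢o a∉M a≋fᵢ) (≢o b∉M b≋fⱼ)

    ∉M-+-∉M : ∀ {a b} → ¬ M a → ¬ M b → M (a + b)
    ∉M-+-∉M {a} {b} a∉M b∉M =
      M-resp (+-congˡ (⁻¹-involutive b)) (∉M⇒≋ a∉M (b∉M ∘ M-resp (⁻¹-involutive b) ∘ -‿∈M))

    sum-parity : ∀ k u → (∀ i → IsUnit′ (u i)) → Parity k (sumᶠ rawRing k u)
    sum-parity zero    u _     = (λ _ → 0∈M) , (λ 2∤0 → contradiction (divides 0 ≡.refl) 2∤0)
    sum-parity (suc k) u units =
      (λ 2∣1+k → ∉M-+-∉M u₀∉M (proj₂ rest (λ 2∣k → 2∣⇒2∤suc 2∣k 2∣1+k))) ,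
      (λ 2∤1+k → ∉M-+-∈M u₀∉M (proj₁ rest (2∤suc⇒2∣ 2∤1+k)))
      where
      u₀∉M = unit⇒∉M (units Fin.zero)
      rest = sum-parity k (u ∘ Fin.suc) (units ∘ Fin.suc)

    sumOfUnits⇒parity : ∀ {k x} → SumOfUnits′ k x → Parity k x
    sumOfUnits⇒parity {k} (u , units , x≈Σu) = Parity-resp (sym x≈Σu) (sum-parity k u units)

    parity⇒sumOfUnits : ∀ {k x} → 1 ≤ k → Parity k x → SumOfUnits′ k x
    parity⇒sumOfUnits {1} _ (_ , odd) =
      sumOfUnits-one (∉M⇒unit (odd (2∣⇒2∤suc (divides 0 ≡.refl))))
    parity⇒sumOfUnits {suc (suc k)} {x} _ (even , odd) =
      sumOfUnits-cons 1-unit (parity⇒sumOfUnits (s≤s z≤n) (even′ , odd′))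
      where
      even′ : 2 ∣ suc k → M (x - 1#)
      even′ 2∣1+k = ∉M⇒≋ (odd (2∣⇒2∤suc 2∣1+k)) proper
      odd′ : ¬ 2 ∣ suc k → ¬ M (x - 1#)
      odd′ 2∤1+k x≋1 = proper (≋0⇒∈M (≋-trans (≋-sym x≋1) (∈M⇒≋0 (even (2∤⇒2∣suc 2∤1+k)))))

module DirectSumProperties {c ℓ} {n : ℕ} (Rs : Fin n → FiniteLocalRing c ℓ) where
  private
    module Rᵢ (i : Fin n) = CommutativeRing (FiniteLocalRing.cring (Rs i))
    module Lᵢ (i : Fin n) = FiniteLocalRingProperties (Rs i)
    Mᵢ = λ i → FiniteLocalRing.M (Rs i)

  Element : Set c
  Element = RawRing.Carrier (DirectSum Rs)

  sumᶠ-component : ∀ k u i → sumᶠ (DirectSum Rs) k u i ≡ sumᶠ (Rᵢ.rawRing i) k (λ j → u j i)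
  sumᶠ-component zero    u i = ≡.refl
  sumᶠ-component (suc k) u i = ≡.cong (Rᵢ._+_ i (u Fin.zero i)) (sumᶠ-component k (u ∘ Fin.suc) i)

  sumOfUnits⇔componentwise : ∀ {k x} →
    SumOfUnits (DirectSum Rs) k x ⇔ (∀ i → SumOfUnits (Rᵢ.rawRing i) k (x i))
  sumOfUnits⇔componentwise {k} {x} = mk⇔ to from
    where
    to : SumOfUnits (DirectSum Rs) k x → ∀ i → SumOfUnits (Rᵢ.rawRing i) k (x i)
    to (u , units , x≈Σu) i =
      (λ j → u j i) , (λ j → proj₁ (units j) i , proj₂ (units j) i) ,
      ≡.subst (Rᵢ._≈_ i (x i)) (sumᶠ-component k u i) (x≈Σu i)
    from : (∀ i → SumOfUnits (Rᵢ.rawRing i) k (x i)) → SumOfUnits (DirectSum Rs) k x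
    from sums = u , (λ j → (λ i → proj₁ (units i j)) , (λ i → proj₂ (units i j))) ,
                λ i → ≡.subst (Rᵢ._≈_ i (x i)) (≡.sym (sumᶠ-component k u i)) (proj₂ (proj₂ (sums i)))
      where
      u : Fin k → Element
      u j i = proj₁ (sums i) j
      units = λ i → proj₁ (proj₂ (sums i))

  ResidueAbove2 : Fin n → Set (c ⊔ ℓ)
  ResidueAbove2 i = ∃ λ q → 2 < q × FiniteLocalRing.ResidueSize (Rs i) q

  residues>2⇒sumOfTwoUnits : (∀ i → ResidueAbove2 i) → ∀ x → SumOfUnits (DirectSum Rs) 2 x
  residues>2⇒sumOfTwoUnits q>2 x = Equivalence.from sumOfUnits⇔componentwise λ i →
    let _ , 2<q , residue = q>2 i in Lᵢ.residue>2⇒sumOfTwoUnits i 2<q residue (x i)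

  ParityCondition : ℕ → ℕ → Element → Set (c ⊔ ℓ)
  ParityCondition s k x = (2 ∣ k → ∀ i → toℕ i < s → Mᵢ i (x i)) ×
                          (¬ 2 ∣ k → ∀ i → toℕ i < s → ¬ Mᵢ i (x i))

  module _ (s : ℕ) (q≡2 : ∀ i → toℕ i < s → FiniteLocalRing.ResidueSize (Rs i) 2) where

    sumOfUnits⇒parityCondition : ∀ {k x} → SumOfUnits (DirectSum Rs) k x → ParityCondition s k x
    sumOfUnits⇒parityCondition sum =
      (λ 2∣k i i<s → proj₁ (parity i i<s) 2∣k) , (λ 2∤k i i<s → proj₂ (parity i i<s) 2∤k)
      where
      parity = λ i i<s → Lᵢ.ResidueTwo.sumOfUnits⇒parity i (q≡2 i i<s)
                           (Equivalence.to sumOfUnits⇔componentwise sum i)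

    sumOfUnits⇔parityCondition : (∀ i → s ≤ toℕ i → ResidueAbove2 i) →
      ∀ k → 2 ≤ k → ∀ x → SumOfUnits (DirectSum Rs) k x ⇔ ParityCondition s k x
    sumOfUnits⇔parityCondition q>2 k 2≤k x =
      mk⇔ sumOfUnits⇒parityCondition λ parity →
        Equivalence.from sumOfUnits⇔componentwise λ i → componentSum parity i (toℕ i <? s)
      where
      componentSum : ParityCondition s k x → ∀ i → Dec (toℕ i < s) → SumOfUnits (Rᵢ.rawRing i) k (x i)
      componentSum (even , odd) i (yes i<s) =
        Lᵢ.ResidueTwo.parity⇒sumOfUnits i (q≡2 i i<s) (ℕₚ.≤-trans (s≤s z≤n) 2≤k)
          ((λ 2∣k → even 2∣k i i<s) , (λ 2∤k → odd 2∤k i i<s))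
      componentSum _ i (no i≮s) =
        let _ , 2<q , residue = q>2 i (≮⇒≥ i≮s) in Lᵢ.residue>2⇒sumOfUnits i 2<q residue 2≤k (x i)

open DirectSumProperties

∀toℕ<1 : ∀ {n p} {P : Fin (suc n) → Set p} → P Fin.zero → ∀ i → toℕ i < 1 → P i
∀toℕ<1 p Fin.zero    _          = p
∀toℕ<1 p (Fin.suc _) (s≤s ())

module _ {c ℓ n} (Rs : Fin (suc (suc n)) → FiniteLocalRing c ℓ) where
  private
    module Rᵢ (i : Fin (suc (suc n))) = CommutativeRing (FiniteLocalRing.cring (Rs i))
    M-maximal = λ i → FiniteLocalRing.M-maximal (Rs i)

  δ₀ : Element Rs
  δ₀ Fin.zero    = Rᵢ.1# Fin.zero
  δ₀ (Fin.suc i) = Rᵢ.0# (Fin.suc i)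

  δ₀-notSumOfUnits : (∀ i → toℕ i < 2 → FiniteLocalRing.ResidueSize (Rs i) 2) →
                     ∀ k → ¬ SumOfUnits (DirectSum Rs) k δ₀
  δ₀-notSumOfUnits q≡2 k sum with 2 ∣? k | sumOfUnits⇒parityCondition Rs 2 q≡2 sum
  ... | yes 2∣k | even , _ = IsMaximalIdeal.proper (M-maximal Fin.zero) (even 2∣k Fin.zero (s≤s z≤n))
  ... | no 2∤k  | _ , odd  = odd 2∤k (Fin.suc Fin.zero) (s≤s (s≤s z≤n))
                               (IsIdeal.zero∈ (IsMaximalIdeal.isIdeal (M-maximal (Fin.suc Fin.zero))))

everySumOfUnits⇒s≡1 : ∀ {c ℓ n} (Rs : Fin n → FiniteLocalRing c ℓ) {s} → 1 ≤ s → s ≤ n →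
  (∀ i → toℕ i < s → FiniteLocalRing.ResidueSize (Rs i) 2) →
  (∀ x → ∃ λ k → SumOfUnits (DirectSum Rs) k x) → s ≡ 1
everySumOfUnits⇒s≡1 Rs {1} _ _ _ _ = ≡.refl
everySumOfUnits⇒s≡1 {n = suc (suc _)} Rs {suc (suc _)} _ (s≤s (s≤s _)) q≡2 every =
  let k , sum = every (δ₀ Rs)
  in ⊥-elim (δ₀-notSumOfUnits Rs (λ i i<2 → q≡2 i (ℕₚ.≤-trans i<2 (s≤s (s≤s z≤n)))) k sum)

s≡1⇒everySumOfUnits : ∀ {c ℓ n} (Rs : Fin n → FiniteLocalRing c ℓ) {s} → s ≤ n →
  (∀ k → 2 ≤ k → ∀ x → SumOfUnits (DirectSum Rs) k x ⇔ ParityCondition Rs s k x) →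
  s ≡ 1 → ∀ x → ∃ λ k → SumOfUnits (DirectSum Rs) k x
s≡1⇒everySumOfUnits {n = suc _} Rs _ characterisation ≡.refl x
  with FiniteLocalRingProperties.em (Rs Fin.zero) {FiniteLocalRing.M (Rs Fin.zero) (x Fin.zero)}
... | yes x₀∈M = 2 , Equivalence.from (characterisation 2 ℕₚ.≤-refl x)
                       ((λ _ → ∀toℕ<1 x₀∈M) , (λ 2∤2 → contradiction (divides 1 ≡.refl) 2∤2))
... | no x₀∉M  = 3 , Equivalence.from (characterisation 3 (s≤s (s≤s z≤n)) x)
                       ((λ 2∣3 → contradiction 2∣3 (2∣⇒2∤suc (divides 1 ≡.refl))) , (λ _ → ∀toℕ<1 x₀∉M))

theorem1p2 : ∀ {c ℓ} (n : ℕ) (Rs : Fin n → FiniteLocalRing c ℓ) →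
    ((∀ i → ∃ λ q → 2 < q × FiniteLocalRing.ResidueSize (Rs i) q) →
      ∀ (x : RawRing.Carrier (DirectSum Rs)) → SumOfUnits (DirectSum Rs) 2 x)
    ×
    (∀ (s : ℕ) → 1 ≤ s → s ≤ n →
      (∀ i → toℕ i < s → FiniteLocalRing.ResidueSize (Rs i) 2) →
      (∀ i → s ≤ toℕ i → ∃ λ q → 2 < q × FiniteLocalRing.ResidueSize (Rs i) q) →
      (∀ (k : ℕ) → 2 ≤ k → ∀ (x : RawRing.Carrier (DirectSum Rs)) →
        SumOfUnits (DirectSum Rs) k x ⇔
          ((2 ∣ k → ∀ i → toℕ i < s → FiniteLocalRing.M (Rs i) (x i)) ×
           (¬ (2 ∣ k) → ∀ i → toℕ i < s → ¬ FiniteLocalRing.M (Rs i) (x i))))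
      ×
      ((∀ (x : RawRing.Carrier (DirectSum Rs)) → ∃ λ k → SumOfUnits (DirectSum Rs) k x) ⇔ (s ≡ 1)))
theorem1p2 n Rs =
  residues>2⇒sumOfTwoUnits Rs ,
  λ s 1≤s s≤n q≡2 q>2 →
    let characterisation = sumOfUnits⇔parityCondition Rs s q≡2 q>2
    in characterisation ,
       mk⇔ (everySumOfUnits⇒s≡1 Rs 1≤s s≤n q≡2) (s≡1⇒everySumOfUnits Rs s≤n characterisation)
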